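{- Let $\varphi$ be a $\mathrm{D}$-formula. The DFA $\tilde{\mathcal{N}}_\varphi$ accepts exactly the nonempty finite words $w$ over $2^{\mathcal{AP}}$ such that $w\models\varphi$.
   Context: Formulas: $\varphi ::= p\mid\neg\varphi\mid\varphi\vee\varphi\mid\langle D\rangle\varphi$, $p\in\mathcal{AP}$ (finite); $[D]\psi:=\neg\langle D\rangle\neg\psi$. Semantics on interval models over finite linear orders: $\langle D\rangle\psi$ holds on $[x,y]$ iff $\psi$ holds on some $[x',y']$ with $x\le x'$, $y'\le y$, $[x',y']\ne[x,y]$. For a nonempty word $w$ over $2^{\mathcal{AP}}$, $\mathbf{M}(w)$ is the interval model over $\{0,\dots,|w|-1\}$ with $[x,y]\in\mathcal{V}(p)$ iff $p\in w[x']$ for all $x'\in[x,y]$ ($w[i]$ the $(i+1)$-th letter); $w\models\varphi$ iff $\mathbf{M}(w),[0,|w|-1]\models\varphi$. $\mathrm{CL}(\varphi)$: subformulas of $\varphi$ and their negations, identifying $\neg\neg\psi$ with $\psi$ and $\neg\langle D\rangle\psi$ with $[D]\neg\psi$. A $\varphi$-atom is $A\subseteq\mathrm{CL}(\varphi)$ with $\psi\in A$ iff $\neg\psi\notin A$ and $\psi_1\vee\psi_2\in A$ iff ($\psi_1\in A$ or $\psi_2\in A$), for all relevant formulas in $\mathrm{CL}(\varphi)$. $\mathcal{R}eq_D(A)=\{\psi:\langle D\rangle\psi\in A\}$, $\mathrm{REQ}_\varphi=\{\psi:\langle D\rangle\psi\in\mathrm{CL}(\varphi)\}$, $\mathcal{O}bs_D(A)=A\cap\mathrm{REQ}_\varphi$.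 $A\,D_\varphi\,A'$ iff for every $[D]\psi\in A$, $\psi\in A'$ and $[D]\psi\in A'$. $A_1A_2\Rightarrow A_3$ iff $A_3\cap\mathcal{AP}=A_1\cap A_2\cap\mathcal{AP}$ and $\mathcal{R}eq_D(A_3)=\mathcal{R}eq_D(A_1)\cup\mathcal{R}eq_D(A_2)\cup\mathcal{O}bs_D(A_1)\cup\mathcal{O}bs_D(A_2)$. A $\varphi$-row is a nonempty sequence $row[0]\cdots row[n-1]$ of atoms with $row[i+1]\,D_\varphi\,row[i]$ and $row[i]\cap\mathcal{AP}\supseteq row[i+1]\cap\mathcal{AP}$; initialized if $\mathcal{R}eq_D(row[0])=\emptyset$. Maximal factorization $A_0^{m_0}\cdots A_k^{m_k}$ ($m_i>0$, $A_i\neq A_{i+1}$). $rank(A)=|\mathrm{REQ}_\varphi|-|\mathcal{R}eq_D(A)|$. Two rows are equivalent ($\sim$) iff their maximal factorizations have the same number of blocks, the same atoms $A_i$, and for each $i$ either equal exponents or both exponents $>rank(A_i)$. A row is minimal if each exponent $m_i\le rank(A_i)+1$. $succ_\varphi(row,A)=B_0\cdots B_n$ ($n=|row|$) with $B_0=A$ and $row[i]B_i\Rightarrow B_{i+1}$; $succ^{min}_\varphi(row,A)$ is the unique minimal row equivalent to it. For $P\subseteq\mathcal{AP}$, $A(P)$ is the unique $\varphi$-atom with $A(P)\cap\mathcal{AP}=P\cap\mathrm{CL}(\varphi)$ and $\mathcal{R}eq_D(A(P))=\emptyset$. $\tilde{\mathcal{N}}_\varphi$ is the DFA over alphabet $2^{\mathcal{AP}}$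 with states the initialized minimal $\varphi$-rows plus a fresh initial state $\tilde q_1$; $\tilde\delta(\tilde q_1,P)$ is the one-letter row $A(P)$, $\tilde\delta(row,P)=succ^{min}_\varphi(row,A(P))$; accepting states are the rows $row$ with $\varphi\in row[|row|-1]$. -}

module Defs where

open import Data.Nat using (ℕ; zero; suc; _∸_; _⊓_)
open import Data.Bool using (Bool; true; false; not; _∧_; _∨_; _xor_; if_then_else_; T)
open import Data.Fin using (Fin; zero; suc; fromℕ) renaming (_≤_ to _≤F_; _≟_ to _≟Fin_)
open import Data.Fin.Subset using (Subset; _∈_)
open import Data.Vec using (Vec) renaming (lookup to vlookup)
open import Data.List using (List; []; _∷_; _++_; length; deduplicateᵇ; mapMaybe; filterᵇ; replicate; concatMap; foldl)

allB : ∀ {A : Set} → (A → Bool) → List A → Bool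
allB p [] = true
allB p (x ∷ xs) = p x ∧ allB p xs
import Data.List as L
open import Data.List.NonEmpty using (List⁺; _∷_; head; tail; toList)
open import Data.Maybe using (Maybe; just; nothing)
open import Data.Product using (_×_; _,_; Σ)
open import Data.Sum using (_⊎_)
open import Relation.Nullary using (¬_; ⌊_⌋)
open import Relation.Binary.PropositionalEquality using (_≡_)

data Form (n : ℕ) : Set where
  prop : Fin n → Form n
  neg  : Form n → Form n
  disj : Form n → Form n → Form n
  dia  : Form n → Form n

box : ∀ {n} → Form n → Form n
box ψ = neg (dia (neg ψ))

formEq : ∀ {n} → Form n → Form n → Bool
formEq (prop p) (prop q) = ⌊ p ≟Fin q ⌋
formEq (neg a) (neg b) = formEq a b
formEq (disj a b) (disj c d) = formEq a c ∧ formEq b d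
formEq (dia a) (dia b) = formEq a b
formEq _ _ = false

len : ∀ {A : Set} → List⁺ A → ℕ
len w = suc (length (tail w))

letter : ∀ {A : Set} (w : List⁺ A) → Fin (len w) → A
letter w zero = head w
letter w (suc i) = L.lookup (tail w) i

Sat : ∀ {n} (w : List⁺ (Subset n)) → Fin (len w) → Fin (len w) → Form n → Set
Sat w x y (prop p) = ∀ (z : Fin (len w)) → x ≤F z → z ≤F y → p ∈ letter w z
Sat w x y (neg ψ) = ¬ Sat w x y ψ
Sat w x y (disj ψ χ) = Sat w x y ψ ⊎ Sat w x y χ
Sat w x y (dia ψ) =
  Σ (Fin (len w)) λ x' → Σ (Fin (len w)) λ y' →
    x ≤F x' × x' ≤F y' × y' ≤F y × ¬ (x' ≡ x × y' ≡ y) × Sat w x' y' ψ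

_⊨_ : ∀ {n} → List⁺ (Subset n) → Form n → Set
w ⊨ φ = Sat w zero (fromℕ (length (tail w))) φ

-- all subformulas of φ.  CL(φ) = SF φ together with the negations of its
-- elements (¬¬ψ identified with ψ, ¬⟨D⟩ψ with [D]¬ψ).
SF : ∀ {n} → Form n → List (Form n)
SF (prop p) = prop p ∷ []
SF (neg ψ) = neg ψ ∷ SF ψ
SF (disj ψ χ) = disj ψ χ ∷ (SF ψ ++ SF χ)
SF (dia ψ) = dia ψ ∷ SF ψ

-- A subset A ⊆ CL(φ) is represented by its membership function;
-- since each element of CL(φ) is some ψ ∈ SF φ or its negation, and an
-- atom contains ¬ψ iff it does not contain ψ, an atom is determined by
-- the values of its membership function on SF φ.  Atoms are compared
-- (as sets) only on SF φ.
Atom : ℕ → Set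
Atom n = Form n → Bool

unDia : ∀ {n} → Form n → Maybe (Form n)
unDia (dia ψ) = just ψ
unDia _ = nothing

REQ : ∀ {n} → Form n → List (Form n)
REQ φ = deduplicateᵇ formEq (mapMaybe unDia (SF φ))

module _ {n : ℕ} (φ : Form n) where

  eqAtom : Atom n → Atom n → Bool
  eqAtom A B = allB (λ ψ → not (A ψ xor B ψ)) (SF φ)

  reqSize : Atom n → ℕ
  reqSize A = length (filterᵇ (λ ψ → A (dia ψ)) (REQ φ))

  rank : Atom n → ℕ
  rank A = length (REQ φ) ∸ reqSize A

-- The unique atom whose AP-part is given by P and whose Req_D-part is
-- given by R (membership in CL(φ) of every formula is then determined).
mkAtom : ∀ {n} → (Fin n → Bool) → (Form n → Bool) → Atom n
mkAtom P R (prop p) = P p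
mkAtom P R (neg ψ) = not (mkAtom P R ψ)
mkAtom P R (disj ψ χ) = mkAtom P R ψ ∨ mkAtom P R χ
mkAtom P R (dia ψ) = R ψ

atomOf : ∀ {n} → Subset n → Atom n
atomOf P = mkAtom (vlookup P) (λ _ → false)

-- the unique A₃ with  A₁ A₂ ⇒ A₃ :
--   A₃ ∩ AP = A₁ ∩ A₂ ∩ AP,
--   Req_D(A₃) = Req_D(A₁) ∪ Req_D(A₂) ∪ Obs_D(A₁) ∪ Obs_D(A₂)
-- (only the values on ψ ∈ REQ_φ / p ∈ CL(φ) matter)
step : ∀ {n} → Atom n → Atom n → Atom n
step A₁ A₂ = mkAtom (λ p → A₁ (prop p) ∧ A₂ (prop p))
                    (λ ψ → A₁ (dia ψ) ∨ A₂ (dia ψ) ∨ A₁ ψ ∨ A₂ ψ)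

Row : ℕ → Set
Row n = List (Atom n)

succ' : ∀ {n} → Row n → Atom n → Row n
succ' [] B = B ∷ []
succ' (r ∷ rs) B = B ∷ succ' rs (step r B)

module _ {n : ℕ} (φ : Form n) where

  factor : Row n → List (Atom n × ℕ)
  factor [] = []
  factor (a ∷ as) with factor as
  ... | [] = (a , 1) ∷ []
  ... | (b , m) ∷ bs = if eqAtom φ a b then (a , suc m) ∷ bs
                                      else (a , 1) ∷ (b , m) ∷ bs

  minimize : Row n → Row n
  minimize row = concatMap (λ { (A , m) → replicate (m ⊓ suc (rank φ A)) A }) (factor row)

  succMin : Row n → Atom n → Row n
  succMin row A = minimize (succ' row A)

  -- The DFA Ñ_φ : states are the fresh initial state q̃₁ (nothing) and
  -- rows (just row); reachable rows are initialized minimal φ-rows.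

  State : Set
  State = Maybe (Row n)

  δ : State → Subset n → State
  δ nothing P = just (atomOf P ∷ [])
  δ (just row) P = just (succMin row (atomOf P))

  accepting : State → Bool
  accepting nothing = false
  accepting (just row) with L.last row
  ... | nothing = false
  ... | just A = A φ

  run : List⁺ (Subset n) → State
  run w = foldl δ nothing (toList w)

  Accepts : List⁺ (Subset n) → Set
  Accepts w = T (accepting (run w))

-- Without minimisation, the row reached after reading w[0..y] lists the
-- atoms of the intervals [y, y], [y-1, y], …, [0, y]: succ' obtains the atom
-- of [x, y+1] from those of [x, y] and [x+1, y+1], since a proper
-- subinterval of [x, y+1] lies in one of them. Its last atom therefore
-- decides w ⊨ φ. Minimisation only shortens blocks X^m with m > rank X + 1.
-- Reading such a block from an atom B iterates step X, which can only
-- enlarge Req_D and, once it stops doing so, is constant; after k steps with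
-- k + rank Y ≤ rank X the block has turned into a block of a fixed atom Y
-- that is still longer than rank Y. Hence rows that differ only in the
-- lengths of long blocks stay so under succ', and share their last atom.

module Submission where

open import Defs
open import Data.Bool using (Bool; true; false; not; _∧_; _∨_; _xor_; T)
open import Data.Bool.Properties using (T?; T-∧; T-∨; T-≡; ∧-assoc; ∧-idem) renaming (_≟_ to _≟ᵇ_)
open import Data.Empty using (⊥-elim)
open import Data.Fin using (Fin; toℕ; fromℕ; fromℕ<) renaming (zero to fzero; suc to fsuc)
open import Data.Fin.Properties using (toℕ-injective; toℕ<n; toℕ-fromℕ; toℕ-fromℕ<) renaming (_≟_ to _≟ᶠ_)
open import Data.Fin.Subset using (Subset) renaming (_∈_ to _∈ˢ_)
open import Data.List using (List; []; _∷_; _++_; length; filterᵇ; take; drop; replicate; foldl)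
import Data.List as List
open import Data.List.NonEmpty using (List⁺; _∷_)
open import Data.List.Properties using (length-filter; ++-assoc; take++drop≡id; length-take; length-drop; length-replicate)
open import Data.List.Membership.Propositional using (_∈_; find)
open import Data.List.Membership.Propositional.Properties using (∈-++⁺ˡ; ∈-++⁺ʳ; ∈-++⁻; ∈-filter⁺; ∈-filter⁻)
open import Data.List.Membership.Setoid.Properties using (∈-deduplicate⁺)
open import Data.List.Relation.Binary.Pointwise using (Pointwise; []; _∷_; Pointwise-≡⇒≡)
open import Data.List.Relation.Binary.Sublist.Propositional using (_⊆_; ⊆-refl)
open import Data.List.Relation.Binary.Sublist.Propositional.Properties using (filter⁺; length-mono-≤; to-≋)
open import Data.List.Relation.Unary.All using (All; []; _∷_; all?) renaming (lookup to All-lookup)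
import Data.List.Relation.Unary.All as All
open import Data.List.Relation.Unary.All.Properties using (¬All⇒Any¬; take⁺; drop⁺; replicate⁺)
open import Data.List.Relation.Unary.Any using (here; there)
import Data.List.Relation.Unary.Any as Any
open import Data.List.Relation.Unary.Any.Properties using (mapMaybe⁺) renaming (map⁺ to Any-map⁺)
open import Data.Maybe using (just)
import Data.Maybe.Relation.Unary.Any as MaybeAny
open import Data.Nat using (ℕ; zero; suc; _+_; _∸_; _⊓_; _≤_; _<_; z≤n; s≤s; _≤?_; _≟_)
open import Data.Nat.Properties
open import Data.Product using (Σ; _×_; _,_; proj₁; proj₂)
open import Data.Product.Function.NonDependent.Propositional using (_×-⇔_)
open import Data.Sum using (_⊎_; inj₁; inj₂)
open import Data.Sum.Function.Propositional using (_⊎-⇔_)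
open import Data.Vec.Properties using (lookup⇒[]=; []=⇒lookup)
open import Function using (_∘_; _∘₂_; case_of_)
open import Function.Bundles using (_⇔_; mk⇔; Equivalence)
open import Level using (0ℓ)
import Function.Properties.Equivalence as ⇔
open import Function.Related.TypeIsomorphisms using (¬-cong-⇔)
open import Relation.Binary.Construct.Closure.ReflexiveTransitive using (Star; ε; _◅_)
import Relation.Binary.Construct.Closure.ReflexiveTransitive as Star
open import Relation.Binary.PropositionalEquality
open import Relation.Nullary using (¬_; yes; no; contradiction; _×-dec_)

open Equivalence using (to; from)

module _ {A : Set} {p q : A → Bool} (p⇒q : ∀ x → T (p x) → T (q x)) where

  filterᵇ-⊆ : ∀ xs → filterᵇ p xs ⊆ filterᵇ q xs
  filterᵇ-⊆ xs = filter⁺ (T? ∘ p) (T? ∘ q) (λ { refl → p⇒q _ }) (⊆-refl {x = xs})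

  length-filterᵇ-mono : ∀ xs → length (filterᵇ p xs) ≤ length (filterᵇ q xs)
  length-filterᵇ-mono xs = length-mono-≤ (filterᵇ-⊆ xs)

  length-filterᵇ-strict : ∀ {xs y} → y ∈ xs → T (q y) → ¬ T (p y) →
    length (filterᵇ p xs) < length (filterᵇ q xs)
  length-filterᵇ-strict {xs} y∈xs qy ¬py = ≤∧≢⇒< (length-filterᵇ-mono xs) λ eq →
    ¬py (proj₂ (∈-filter⁻ (T? ∘ p) {xs = xs}
      (subst (_ ∈_) (sym (Pointwise-≡⇒≡ (to-≋ eq (filterᵇ-⊆ xs)))) (∈-filter⁺ (T? ∘ q) y∈xs qy))))

SF-refl : ∀ {n} (φ : Form n) → φ ∈ SF φ
SF-refl (prop _) = here refl
SF-refl (neg _) = here refl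
SF-refl (disj _ _) = here refl
SF-refl (dia _) = here refl

SF-trans : ∀ {n} (φ : Form n) {χ ψ} → χ ∈ SF φ → ψ ∈ SF χ → ψ ∈ SF φ
SF-trans (prop _) (here refl) m = m
SF-trans (neg _) (here refl) m = m
SF-trans (disj _ _) (here refl) m = m
SF-trans (dia _) (here refl) m = m
SF-trans (neg φ) (there c) m = there (SF-trans φ c m)
SF-trans (dia φ) (there c) m = there (SF-trans φ c m)
SF-trans (disj φ φ′) (there c) m with ∈-++⁻ (SF φ) c
... | inj₁ c′ = there (∈-++⁺ˡ (SF-trans φ c′ m))
... | inj₂ c′ = there (∈-++⁺ʳ (SF φ) (SF-trans φ′ c′ m))

formEq-sound : ∀ {n} (φ ψ : Form n) → T (formEq φ ψ) → φ ≡ ψ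
formEq-sound (prop p) (prop q) t with p ≟ᶠ q
... | yes refl = refl
formEq-sound (neg φ) (neg ψ) t = cong neg (formEq-sound φ ψ t)
formEq-sound (disj φ φ′) (disj ψ ψ′) t =
  cong₂ disj (formEq-sound φ ψ (proj₁ (to T-∧ t))) (formEq-sound φ′ ψ′ (proj₂ (to T-∧ t)))
formEq-sound (dia φ) (dia ψ) t = cong dia (formEq-sound φ ψ t)

dia∈SF⇒∈REQ : ∀ {n} (φ : Form n) {ψ} → dia ψ ∈ SF φ → ψ ∈ REQ φ
dia∈SF⇒∈REQ φ m =
  ∈-deduplicate⁺ (setoid _) (T? ∘₂ formEq) (λ r x≡y → trans x≡y (sym (formEq-sound _ _ r)))
    (mapMaybe⁺ unDia (SF φ) (Any-map⁺ (Any.map (λ { refl → MaybeAny.just refl }) m)))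

mkAtom-cong : ∀ {n} (χ : Form n) {P P′ : Fin n → Bool} {R R′ : Form n → Bool} →
  (∀ p → prop p ∈ SF χ → P p ≡ P′ p) → (∀ ψ → dia ψ ∈ SF χ → R ψ ≡ R′ ψ) →
  mkAtom P R χ ≡ mkAtom P′ R′ χ
mkAtom-cong (prop p) hP hR = hP p (here refl)
mkAtom-cong (neg χ) hP hR = cong not (mkAtom-cong χ (λ p → hP p ∘ there) (λ ψ → hR ψ ∘ there))
mkAtom-cong (disj χ χ′) hP hR = cong₂ _∨_
  (mkAtom-cong χ (λ p → hP p ∘ there ∘ ∈-++⁺ˡ) (λ ψ → hR ψ ∘ there ∘ ∈-++⁺ˡ))
  (mkAtom-cong χ′ (λ p → hP p ∘ there ∘ ∈-++⁺ʳ (SF χ)) (λ ψ → hR ψ ∘ there ∘ ∈-++⁺ʳ (SF χ)))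
mkAtom-cong (dia χ) hP hR = hR χ (here refl)

module _ {n : ℕ} (φ : Form n) where

  infix 4 _≈_
  record _≈_ (A B : Atom n) : Set where
    constructor mk≈
    field agree : ∀ {χ} → χ ∈ SF φ → A χ ≡ B χ
  open _≈_

  ≈-refl : ∀ {A} → A ≈ A
  ≈-refl = mk≈ λ _ → refl

  ≈-sym : ∀ {A B} → A ≈ B → B ≈ A
  ≈-sym A≈B = mk≈ (sym ∘ agree A≈B)

  ≈-trans : ∀ {A B C} → A ≈ B → B ≈ C → A ≈ C
  ≈-trans A≈B B≈C = mk≈ λ m → trans (agree A≈B m) (agree B≈C m)

  neg∈SF : ∀ {ψ} → neg ψ ∈ SF φ → ψ ∈ SF φ
  neg∈SF m = SF-trans φ m (there (SF-refl _))

  dia∈SF : ∀ {ψ} → dia ψ ∈ SF φ → ψ ∈ SF φ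
  dia∈SF m = SF-trans φ m (there (SF-refl _))

  step-cong : ∀ {A₁ A₂ B₁ B₂} → A₁ ≈ B₁ → A₂ ≈ B₂ → step A₁ A₂ ≈ step B₁ B₂
  step-cong (mk≈ e₁) (mk≈ e₂) = mk≈ λ {χ} m → mkAtom-cong χ
    (λ p mp → let mp′ = SF-trans φ m mp in cong₂ _∧_ (e₁ mp′) (e₂ mp′))
    (λ ψ mψ → let md = SF-trans φ m mψ ; m₀ = dia∈SF md in
      cong₂ _∨_ (e₁ md) (cong₂ _∨_ (e₂ md) (cong₂ _∨_ (e₁ m₀) (e₂ m₀))))

  step-congʳ : ∀ X {C D} → C ≈ D → step X C ≈ step X D
  step-congʳ X = step-cong {X} {B₁ = X} ≈-refl

  eqAtom⇒≈ : ∀ {A B} → T (eqAtom φ A B) → A ≈ B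
  eqAtom⇒≈ {A} {B} = mk≈ ∘ agreeOn (SF φ)
    where
      agreeOn : ∀ xs → T (allB (λ ψ → not (A ψ xor B ψ)) xs) → ∀ {χ} → χ ∈ xs → A χ ≡ B χ
      agreeOn (ψ ∷ xs) t (here refl) with A ψ | B ψ
      ... | true  | true  = refl
      ... | false | false = refl
      agreeOn (ψ ∷ xs) t (there m) with A ψ | B ψ | t
      ... | true  | true  | t′ = agreeOn xs t′ m
      ... | false | false | t′ = agreeOn xs t′ m

  infix 4 _⊆Req_
  record _⊆Req_ (A B : Atom n) : Set where
    constructor mk⊆Req
    field ⊆Req : ∀ ψ → T (A (dia ψ)) → T (B (dia ψ))

  rank-antimono : ∀ {A B} → A ⊆Req B → rank φ B ≤ rank φ A
  rank-antimono (mk⊆Req A⊆B) = ∸-monoʳ-≤ (length (REQ φ)) (length-filterᵇ-mono A⊆B (REQ φ))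

  rank-strict : ∀ {A B ψ} → A ⊆Req B → ψ ∈ REQ φ → B (dia ψ) ≢ A (dia ψ) → rank φ B < rank φ A
  rank-strict {A} {B} {ψ} (mk⊆Req A⊆B) ψ∈ B≢A =
    ∸-monoʳ-< (length-filterᵇ-strict A⊆B ψ∈ (proj₁ new) (proj₂ new)) (length-filter _ (REQ φ))
    where
      only-in : ∀ b a → (T a → T b) → b ≢ a → T b × ¬ T a
      only-in true true _ b≢a = contradiction refl b≢a
      only-in true false _ _ = _ , λ ()
      only-in false true a⇒b _ = ⊥-elim (a⇒b _)
      only-in false false _ b≢a = contradiction refl b≢a
      new = only-in (B (dia ψ)) (A (dia ψ)) (A⊆B ψ) B≢A

  step-⊆Reqˡ : ∀ X B → X ⊆Req step X B
  step-⊆Reqˡ X B = mk⊆Req λ ψ t → from (T-∨ {X (dia ψ)}) (inj₁ t)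

  step-⊆Reqʳ : ∀ X B → B ⊆Req step X B
  step-⊆Reqʳ X B = mk⊆Req λ ψ t → from (T-∨ {X (dia ψ)}) (inj₂ (from (T-∨ {B (dia ψ)}) (inj₁ t)))

  -- A further application of step X leaves the AP-part unchanged, so it
  -- either changes nothing or strictly enlarges Req_D.
  step-fixed-or-grows : ∀ X C →
    step X (step X C) ≈ step X C ⊎ rank φ (step X (step X C)) < rank φ (step X C)
  step-fixed-or-grows X C with all? (λ ψ → step X (step X C) (dia ψ) ≟ᵇ step X C (dia ψ)) (REQ φ)
  ... | yes same = inj₁ (mk≈ λ {χ} m → mkAtom-cong χ
        (λ p _ → let x = X (prop p) ; c = C (prop p) in
                   trans (sym (∧-assoc x x c)) (cong (_∧ c) (∧-idem x)))
        (λ ψ mψ → All-lookup same (dia∈SF⇒∈REQ φ (SF-trans φ m mψ))))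
  ... | no differ with find (¬All⇒Any¬ (λ _ → _ ≟ᵇ _) (REQ φ) differ)
  ...   | ψ , ψ∈ , differs = inj₂ (rank-strict (step-⊆Reqʳ X (step X C)) ψ∈ differs)

  stepⁿ : Atom n → ℕ → Atom n → Atom n
  stepⁿ X zero C = C
  stepⁿ X (suc j) C = step X (stepⁿ X j C)

  stepⁿ-fixed : ∀ X B j → step X (stepⁿ X j B) ≈ stepⁿ X j B →
    ∀ i → stepⁿ X (i + j) B ≈ stepⁿ X j B
  stepⁿ-fixed X B j fixed zero = ≈-refl
  stepⁿ-fixed X B j fixed (suc i) = ≈-trans (step-congʳ X (stepⁿ-fixed X B j fixed i)) fixed

  SaturatesAt : Atom n → Atom n → ℕ → Set
  SaturatesAt X B k =
    k + rank φ (stepⁿ X (suc k) B) ≤ rank φ X × step X (stepⁿ X (suc k) B) ≈ stepⁿ X (suc k) B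

  -- Each non-fixing application of step X lowers the rank, which starts
  -- below rank X.
  saturation : ∀ X B → Σ ℕ (SaturatesAt X B)
  saturation X B = go (rank φ (step X B)) 0 ≤-refl (rank-antimono (step-⊆Reqˡ X B))
    where
      go : ∀ fuel k → rank φ (stepⁿ X (suc k) B) ≤ fuel →
        k + rank φ (stepⁿ X (suc k) B) ≤ rank φ X → Σ ℕ (SaturatesAt X B)
      go fuel k _ bound with step-fixed-or-grows X (stepⁿ X k B)
      ... | inj₁ fixed = k , bound , fixed
      go zero k r≤0 bound | inj₂ r< = contradiction (≤-trans r< r≤0) λ ()
      go (suc fuel) k r≤ bound | inj₂ r< = go fuel (suc k) (≤-pred (≤-trans r< r≤))
        (≤-trans (≤-reflexive (sym (+-suc k _))) (≤-trans (+-monoʳ-≤ k r<) bound))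

  steps : Row n → Atom n → Row n
  steps [] B = []
  steps (A ∷ r) B = step A B ∷ steps r (step A B)

  final : Row n → Atom n → Atom n
  final [] B = B
  final (A ∷ r) B = final r (step A B)

  succ'≡∷steps : ∀ r B → succ' r B ≡ B ∷ steps r B
  succ'≡∷steps [] B = refl
  succ'≡∷steps (A ∷ r) B = cong (B ∷_) (succ'≡∷steps r (step A B))

  length-steps : ∀ r B → length (steps r B) ≡ length r
  length-steps [] B = refl
  length-steps (A ∷ r) B = cong suc (length-steps r (step A B))

  steps-++ : ∀ xs r B → steps (xs ++ r) B ≡ steps xs B ++ steps r (final xs B)
  steps-++ [] r B = refl
  steps-++ (A ∷ xs) r B = cong (step A B ∷_) (steps-++ xs r (step A B))

  steps-++-split : ∀ k xs r B → steps (xs ++ r) B ≡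
    steps (take k xs) B ++ steps (drop k xs) (final (take k xs) B) ++ steps r (final xs B)
  steps-++-split k xs r B = begin
    steps (xs ++ r) B                      ≡⟨ steps-++ xs r B ⟩
    steps xs B ++ steps r (final xs B)     ≡⟨ cong (_++ steps r (final xs B)) split ⟩
    (steps (take k xs) B ++ steps (drop k xs) (final (take k xs) B)) ++ steps r (final xs B)
                                           ≡⟨ ++-assoc (steps (take k xs) B) _ _ ⟩
    steps (take k xs) B ++ steps (drop k xs) (final (take k xs) B) ++ steps r (final xs B) ∎
    where
      open ≡-Reasoning
      split : steps xs B ≡ steps (take k xs) B ++ steps (drop k xs) (final (take k xs) B)
      split = trans (cong (λ l → steps l B) (sym (take++drop≡id k xs))) (steps-++ (take k xs) (drop k xs) B)

  steps-≋ : ∀ {xs ys C C′} → Pointwise _≈_ xs ys → C ≈ C′ → Pointwise _≈_ (steps xs C) (steps ys C′)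
  steps-≋ [] _ = []
  steps-≋ (x≈y ∷ xs≋ys) C≈C′ = s ∷ steps-≋ xs≋ys s
    where s = step-cong x≈y C≈C′

  Block : Atom n → Row n → Set
  Block X = All (_≈ X)

  block-≋ : ∀ {X xs ys} → Block X xs → Block X ys → length xs ≡ length ys → Pointwise _≈_ xs ys
  block-≋ [] [] _ = []
  block-≋ (x≈ ∷ xs≈) (y≈ ∷ ys≈) eq = ≈-trans x≈ (≈-sym y≈) ∷ block-≋ xs≈ ys≈ (suc-injective eq)

  final-block : ∀ {X xs C} B j → Block X xs → C ≈ stepⁿ X j B →
    final xs C ≈ stepⁿ X (length xs + j) B
  final-block B j [] C≈ = C≈
  final-block {X} {x ∷ xs} {C} B j (x≈ ∷ xs≈) C≈ =
    subst (λ i → final xs (step x C) ≈ stepⁿ X i B) (+-suc (length xs) j)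
      (final-block B (suc j) xs≈ (step-cong x≈ C≈))

  steps-block-fixed : ∀ {X Y xs D} → Block X xs → step X D ≈ Y → step X Y ≈ Y → Block Y (steps xs D)
  steps-block-fixed [] _ _ = []
  steps-block-fixed {X} {Y} {x ∷ _} {D} (x≈ ∷ xs≈) next fixed =
    s ∷ steps-block-fixed xs≈ (≈-trans (step-congʳ X s) fixed) fixed
    where
      s : step x D ≈ Y
      s = ≈-trans (step-cong x≈ (≈-refl {D})) next

  -- After k steps (k from saturation X B) any long enough X-block read
  -- from B has become a block of the fixed atom Y, itself long enough.
  module BlockSaturation (X B : Atom n) where

    k : ℕ
    k = proj₁ (saturation X B)

    Y : Atom n
    Y = stepⁿ X (suc k) B

    k+rankY≤rankX : k + rank φ Y ≤ rank φ X
    k+rankY≤rankX = proj₁ (proj₂ (saturation X B))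

    Y-fixed : step X Y ≈ Y
    Y-fixed = proj₂ (proj₂ (saturation X B))

    module _ {xs : Row n} (long : rank φ X < length xs) where

      k<length : k < length xs
      k<length = ≤-trans (s≤s (m+n≤o⇒m≤o k k+rankY≤rankX)) long

      length-take-k : length (take k xs) ≡ k
      length-take-k = trans (length-take k xs) (m≤n⇒m⊓n≡m (<⇒≤ k<length))

      tail-long : ∀ D → rank φ Y < length (steps (drop k xs) D)
      tail-long D = begin-strict
        rank φ Y                         <⟨ m+n≤o⇒m≤o∸n (suc (rank φ Y)) 1+rankY+k≤length ⟩
        length xs ∸ k                    ≡⟨ sym (length-drop k xs) ⟩
        length (drop k xs)               ≡⟨ sym (length-steps (drop k xs) D) ⟩
        length (steps (drop k xs) D)     ∎
        where
          open ≤-Reasoning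
          1+rankY+k≤length : suc (rank φ Y + k) ≤ length xs
          1+rankY+k≤length = ≤-trans (s≤s (≤-reflexive (+-comm (rank φ Y) k)))
                                     (≤-trans (s≤s k+rankY≤rankX) long)

      module _ {C} (xs≈ : Block X xs) (C≈ : C ≈ B) where

        final-take : final (take k xs) C ≈ stepⁿ X k B
        final-take = subst (λ i → final (take k xs) C ≈ stepⁿ X i B)
          (trans (+-identityʳ (length (take k xs))) length-take-k) (final-block B 0 (take⁺ k xs≈) C≈)

        tail-block : Block Y (steps (drop k xs) (final (take k xs) C))
        tail-block = steps-block-fixed (drop⁺ k xs≈) (step-congʳ X final-take) Y-fixed

        final-saturated : final xs C ≈ Y
        final-saturated = ≈-trans
          (subst (λ i → final xs C ≈ stepⁿ X i B) length≡ (final-block B 0 xs≈ C≈))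
          (stepⁿ-fixed X B (suc k) Y-fixed (length xs ∸ suc k))
          where
            length≡ : length xs + 0 ≡ (length xs ∸ suc k) + suc k
            length≡ = trans (+-identityʳ (length xs)) (sym (m∸n+n≡m k<length))

  -- The paper's ∼, with blocks that need not be maximal: rows are cut
  -- into matching pieces that are either ≈-equal atoms or blocks of one
  -- atom X both longer than rank X.
  infix 4 _∼_
  data _∼_ : Row n → Row n → Set where
    [] : [] ∼ []
    _∷_ : ∀ {A B r e} → A ≈ B → r ∼ e → A ∷ r ∼ B ∷ e
    saturated : ∀ {X xs ys r e} → Block X xs → Block X ys →
      rank φ X < length xs → rank φ X < length ys → r ∼ e → xs ++ r ∼ ys ++ e

  ≋-++-∼ : ∀ {xs ys r e} → Pointwise _≈_ xs ys → r ∼ e → xs ++ r ∼ ys ++ e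
  ≋-++-∼ [] r∼e = r∼e
  ≋-++-∼ (x≈y ∷ xs≋ys) r∼e = x≈y ∷ ≋-++-∼ xs≋ys r∼e

  steps-∼ : ∀ {r e B B′} → r ∼ e → B ≈ B′ → steps r B ∼ steps e B′
  steps-∼ [] _ = []
  steps-∼ (A≈A′ ∷ r∼e) B≈B′ = s ∷ steps-∼ r∼e s
    where s = step-cong A≈A′ B≈B′
  steps-∼ {B = B} {B′} (saturated {X} {xs} {ys} {r} {e} xs≈X ys≈X xs-long ys-long r∼e) B≈B′ =
    subst₂ _∼_ (sym (steps-++-split k xs r B)) (sym (steps-++-split k ys e B′))
      (≋-++-∼ (steps-≋ heads B≈B′)
        (saturated (tail-block xs-long xs≈X ≈-refl) (tail-block ys-long ys≈X B′≈B)
          (tail-long xs-long _) (tail-long ys-long _)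
          (steps-∼ r∼e (≈-trans (final-saturated xs-long xs≈X ≈-refl)
                                 (≈-sym (final-saturated ys-long ys≈X B′≈B))))))
    where
      open BlockSaturation X B
      B′≈B = ≈-sym B≈B′
      heads : Pointwise _≈_ (take k xs) (take k ys)
      heads = block-≋ (take⁺ k xs≈X) (take⁺ k ys≈X)
                      (trans (length-take-k xs-long) (sym (length-take-k ys-long)))

  succ'-∼ : ∀ {r e} B → r ∼ e → succ' r B ∼ succ' e B
  succ'-∼ {r} {e} B r∼e = subst₂ _∼_ (sym (succ'≡∷steps r B)) (sym (succ'≡∷steps e B))
    (≈-refl ∷ steps-∼ r∼e ≈-refl)

  lastOr : Atom n → Row n → Atom n
  lastOr A [] = A
  lastOr _ (A ∷ r) = lastOr A r

  lastOr-++ : ∀ A xs r → lastOr A (xs ++ r) ≡ lastOr (lastOr A xs) r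
  lastOr-++ A [] r = refl
  lastOr-++ A (B ∷ xs) r = lastOr-++ B xs r

  lastOr-block : ∀ {X xs} A → Block X xs → 0 < length xs → lastOr A xs ≈ X
  lastOr-block A (x≈ ∷ []) _ = x≈
  lastOr-block A (_ ∷ x≈ ∷ xs≈) _ = lastOr-block A (x≈ ∷ xs≈) (s≤s z≤n)

  lastOr-∼ : ∀ {r e A B} → r ∼ e → A ≈ B → lastOr A r ≈ lastOr B e
  lastOr-∼ [] A≈B = A≈B
  lastOr-∼ (A≈B ∷ r∼e) _ = lastOr-∼ r∼e A≈B
  lastOr-∼ {A = A} {B} (saturated {X} {xs} {ys} {r} {e} xs≈X ys≈X xs-long ys-long r∼e) _ =
    subst₂ _≈_ (sym (lastOr-++ A xs r)) (sym (lastOr-++ B ys e))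
      (lastOr-∼ r∼e (≈-trans (lastOr-block A xs≈X (≤-trans (s≤s z≤n) xs-long))
                             (≈-sym (lastOr-block B ys≈X (≤-trans (s≤s z≤n) ys-long)))))

  data Factorization : List (Atom n × ℕ) → Row n → Set where
    [] : Factorization [] []
    block : ∀ {A xs fs r} → Block A xs → Factorization fs r → Factorization ((A , length xs) ∷ fs) (xs ++ r)

  factorization : ∀ row → Factorization (factor φ row) row
  factorization [] = []
  factorization (A ∷ row) with factor φ row | factorization row
  ... | [] | [] = block (≈-refl ∷ []) []
  ... | (B , _) ∷ _ | block xs≈B f with eqAtom φ A B in A≟B
  ...   | true = block (≈-refl ∷ All.map (λ x≈B → ≈-trans x≈B (≈-sym A≈B)) xs≈B) f
    where A≈B = eqAtom⇒≈ (subst T (sym A≟B) _)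
  ...   | false = block (≈-refl ∷ []) (block xs≈B f)

  replicate-≋ : ∀ {A xs} → Block A xs → Pointwise _≈_ (replicate (length xs) A) xs
  replicate-≋ [] = []
  replicate-≋ (x≈ ∷ xs≈) = ≈-sym x≈ ∷ replicate-≋ xs≈

  -- G stands for the pattern-matching lambda inside minimize.
  concatMap-replicate-∼ : (G : Atom n × ℕ → Row n) →
    (∀ A m → G (A , m) ≡ replicate (m ⊓ suc (rank φ A)) A) →
    ∀ {fs row} → Factorization fs row → List.concatMap G fs ∼ row
  concatMap-replicate-∼ G G≡ [] = []
  concatMap-replicate-∼ G G≡ (block {A} {xs} xs≈ f) with length xs ≤? suc (rank φ A)
  ... | yes short rewrite G≡ A (length xs) | m≤n⇒m⊓n≡m short =
    ≋-++-∼ (replicate-≋ xs≈) (concatMap-replicate-∼ G G≡ f)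
  ... | no long rewrite G≡ A (length xs) | m≥n⇒m⊓n≡n (<⇒≤ (≰⇒> long)) =
    saturated (replicate⁺ (suc (rank φ A)) ≈-refl) xs≈
      (≤-reflexive (sym (length-replicate (suc (rank φ A))))) (<⇒≤ (≰⇒> long))
      (concatMap-replicate-∼ G G≡ f)

  minimize-∼ : ∀ row → minimize φ row ∼ row
  minimize-∼ row = concatMap-replicate-∼ _ (λ _ _ → refl) (factorization row)

  infix 4 _∼*_
  _∼*_ : Row n → Row n → Set
  _∼*_ = Star _∼_

  succMin-∼* : ∀ {r e} B → r ∼* e → succMin φ r B ∼* succ' e B
  succMin-∼* {r} B r∼*e = minimize-∼ (succ' r B) ◅ Star.gmap (λ r → succ' r B) (succ'-∼ B) r∼*e

  lastOr-∼* : ∀ {r e A B} → r ∼* e → A ≈ B → lastOr A r ≈ lastOr B e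
  lastOr-∼* {[]} ε A≈B = A≈B
  lastOr-∼* {_ ∷ _} ε _ = ≈-refl
  lastOr-∼* {B = B} (r∼s ◅ s∼*e) A≈B = ≈-trans (lastOr-∼ r∼s A≈B) (lastOr-∼* s∼*e (≈-refl {B}))

lookupOr : ∀ {A : Set} → A → List A → ℕ → A
lookupOr d [] _ = d
lookupOr d (x ∷ xs) zero = x
lookupOr d (x ∷ xs) (suc i) = lookupOr d xs i

letterℕ : ∀ {n} → List⁺ (Subset n) → ℕ → Subset n
letterℕ (P ∷ Ps) = lookupOr P (P ∷ Ps)

Satℕ : ∀ {n} → (ℕ → Subset n) → ℕ → ℕ → Form n → Set
Satℕ L x y (prop p) = ∀ z → x ≤ z → z ≤ y → p ∈ˢ L z
Satℕ L x y (neg ψ) = ¬ Satℕ L x y ψ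
Satℕ L x y (disj ψ χ) = Satℕ L x y ψ ⊎ Satℕ L x y χ
Satℕ L x y (dia ψ) = Σ ℕ λ x′ → Σ ℕ λ y′ →
  x ≤ x′ × x′ ≤ y′ × y′ ≤ y × ¬ (x′ ≡ x × y′ ≡ y) × Satℕ L x′ y′ ψ

letter≡letterℕ : ∀ {n} (w : List⁺ (Subset n)) (z : Fin (len w)) → letter w z ≡ letterℕ w (toℕ z)
letter≡letterℕ (P ∷ Ps) fzero = refl
letter≡letterℕ (P ∷ Ps) (fsuc i) = lookup≡lookupOr Ps i
  where
    lookup≡lookupOr : ∀ xs (i : Fin (length xs)) → List.lookup xs i ≡ lookupOr P xs (toℕ i)
    lookup≡lookupOr (x ∷ xs) fzero = refl
    lookup≡lookupOr (x ∷ xs) (fsuc i) = lookup≡lookupOr xs i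

toℕ-onto : ∀ {m} z → z < m → Σ (Fin m) λ i → toℕ i ≡ z
toℕ-onto z z<m = fromℕ< z<m , toℕ-fromℕ< z<m

Sat⇔Satℕ : ∀ {n} (w : List⁺ (Subset n)) χ (x y : Fin (len w)) →
  Sat w x y χ ⇔ Satℕ (letterℕ w) (toℕ x) (toℕ y) χ
Sat⇔Satℕ w (prop p) x y =
  mk⇔ to′ (λ h z x≤z z≤y → subst (p ∈ˢ_) (sym (letter≡letterℕ w z)) (h (toℕ z) x≤z z≤y))
  where
    to′ : Sat w x y (prop p) → Satℕ (letterℕ w) (toℕ x) (toℕ y) (prop p)
    to′ h z x≤z z≤y with toℕ-onto {len w} z (≤-trans (s≤s z≤y) (toℕ<n y))
    ... | i , refl = subst (p ∈ˢ_) (letter≡letterℕ w i) (h i x≤z z≤y)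
Sat⇔Satℕ w (neg ψ) x y = ¬-cong-⇔ (Sat⇔Satℕ w ψ x y)
Sat⇔Satℕ w (disj ψ χ) x y = Sat⇔Satℕ w ψ x y ⊎-⇔ Sat⇔Satℕ w χ x y
Sat⇔Satℕ w (dia ψ) x y = mk⇔ to′ from′
  where
    to′ : Sat w x y (dia ψ) → Satℕ (letterℕ w) (toℕ x) (toℕ y) (dia ψ)
    to′ (x′ , y′ , x≤x′ , x′≤y′ , y′≤y , proper , s) =
      toℕ x′ , toℕ y′ , x≤x′ , x′≤y′ , y′≤y ,
      (λ (e₁ , e₂) → proper (toℕ-injective e₁ , toℕ-injective e₂)) , to (Sat⇔Satℕ w ψ x′ y′) s
    from′ : Satℕ (letterℕ w) (toℕ x) (toℕ y) (dia ψ) → Sat w x y (dia ψ)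
    from′ (x′ , y′ , x≤x′ , x′≤y′ , y′≤y , proper , s)
      with toℕ-onto {len w} x′ (≤-trans (s≤s (≤-trans x′≤y′ y′≤y)) (toℕ<n y))
         | toℕ-onto {len w} y′ (≤-trans (s≤s y′≤y) (toℕ<n y))
    ... | i , refl | j , refl = i , j , x≤x′ , x′≤y′ , y′≤y ,
      (λ (e₁ , e₂) → proper (cong toℕ e₁ , cong toℕ e₂)) , from (Sat⇔Satℕ w ψ i j) s

T-not : ∀ b → T (not b) ⇔ (¬ T b)
T-not true = mk⇔ (λ ()) (λ ¬t → ¬t _)
T-not false = mk⇔ (λ _ ()) (λ _ → _)

module _ {n} (L : ℕ → Subset n) {x y : ℕ} (x≤y : x ≤ y) where

  prop-split : ∀ p → Satℕ L x (suc y) (prop p) ⇔ (Satℕ L x y (prop p) × Satℕ L (suc x) (suc y) (prop p))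
  prop-split p = mk⇔
    (λ h → (λ z x≤z z≤y → h z x≤z (m≤n⇒m≤1+n z≤y)) , (λ z x<z z≤1+y → h z (<⇒≤ x<z) z≤1+y))
    (λ (h₁ , h₂) z x≤z z≤1+y → case z ≤? y of λ
      { (yes z≤y) → h₁ z x≤z z≤y
      ; (no z≰y) → h₂ z (≤-trans (s≤s x≤y) (≰⇒> z≰y)) z≤1+y })

  dia-split : ∀ ψ → Satℕ L x (suc y) (dia ψ) ⇔
    (Satℕ L x y (dia ψ) ⊎ Satℕ L (suc x) (suc y) (dia ψ) ⊎ Satℕ L x y ψ ⊎ Satℕ L (suc x) (suc y) ψ)
  dia-split ψ = mk⇔ split join
    where
      Parts : Set
      Parts = Satℕ L x y (dia ψ) ⊎ Satℕ L (suc x) (suc y) (dia ψ) ⊎ Satℕ L x y ψ ⊎ Satℕ L (suc x) (suc y) ψ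

      split : Satℕ L x (suc y) (dia ψ) → Parts
      split (x′ , y′ , x≤x′ , x′≤y′ , y′≤1+y , proper , s) with y′ ≤? y
      ... | yes y′≤y with x′ ≟ x ×-dec y′ ≟ y
      ...   | yes (refl , refl) = inj₂ (inj₂ (inj₁ s))
      ...   | no ≢[x,y] = inj₁ (x′ , y′ , x≤x′ , x′≤y′ , y′≤y , ≢[x,y] , s)
      split (x′ , y′ , x≤x′ , x′≤y′ , y′≤1+y , proper , s) | no y′≰y
        with ≤-antisym y′≤1+y (≰⇒> y′≰y) | x′ ≟ suc x ×-dec y′ ≟ suc y
      ... | refl | yes (refl , refl) = inj₂ (inj₂ (inj₂ s))
      ... | refl | no ≢[1+x,1+y] = inj₂ (inj₁ (x′ , y′ , x<x′ , x′≤y′ , y′≤1+y , ≢[1+x,1+y] , s))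
        where x<x′ = ≤∧≢⇒< x≤x′ (λ x≡x′ → proper (sym x≡x′ , refl))
      join : Parts → Satℕ L x (suc y) (dia ψ)
      join (inj₁ (x′ , y′ , x≤x′ , x′≤y′ , y′≤y , _ , s)) =
        x′ , y′ , x≤x′ , x′≤y′ , m≤n⇒m≤1+n y′≤y , (λ { (_ , refl) → 1+n≰n y′≤y }) , s
      join (inj₂ (inj₁ (x′ , y′ , x<x′ , x′≤y′ , y′≤1+y , _ , s))) =
        x′ , y′ , <⇒≤ x<x′ , x′≤y′ , y′≤1+y , (λ { (refl , _) → 1+n≰n x<x′ }) , s
      join (inj₂ (inj₂ (inj₁ s))) =
        x , y , ≤-refl , x≤y , n≤1+n y , (λ (_ , y≡1+y) → 1+n≢n (sym y≡1+y)) , s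
      join (inj₂ (inj₂ (inj₂ s))) =
        suc x , suc y , n≤1+n x , s≤s x≤y , ≤-refl , (λ (1+x≡x , _) → 1+n≢n 1+x≡x) , s

module _ {n} (φ : Form n) (L : ℕ → Subset n) where

  Describes : ℕ → ℕ → Atom n → Set
  Describes x y A = ∀ {χ} → χ ∈ SF φ → T (A χ) ⇔ Satℕ L x y χ

  mkAtom-describes : ∀ {x y} {P : Fin n → Bool} {R : Form n → Bool} →
    (∀ p → prop p ∈ SF φ → T (P p) ⇔ Satℕ L x y (prop p)) →
    (∀ ψ → dia ψ ∈ SF φ → T (R ψ) ⇔ Satℕ L x y (dia ψ)) →
    Describes x y (mkAtom P R)
  mkAtom-describes hP hR {prop p} m = hP p m
  mkAtom-describes {P = P} {R} hP hR {neg ψ} m =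
    ⇔.trans (T-not (mkAtom P R ψ)) (¬-cong-⇔ (mkAtom-describes hP hR (neg∈SF φ m)))
  mkAtom-describes hP hR {disj ψ χ} m = ⇔.trans T-∨
    (mkAtom-describes hP hR (SF-trans φ m (there (∈-++⁺ˡ (SF-refl ψ)))) ⊎-⇔
     mkAtom-describes hP hR (SF-trans φ m (there (∈-++⁺ʳ (SF ψ) (SF-refl χ)))))
  mkAtom-describes hP hR {dia ψ} m = hR ψ m

  atomOf-describes : ∀ y → Describes y y (atomOf (L y))
  atomOf-describes y = mkAtom-describes
    (λ p _ → mk⇔
      (λ t z y≤z z≤y → subst (λ z → p ∈ˢ L z) (≤-antisym y≤z z≤y) (lookup⇒[]= p (L y) (to T-≡ t)))
      (λ h → from T-≡ ([]=⇒lookup (h y ≤-refl ≤-refl))))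
    (λ ψ _ → mk⇔ (λ ())
      (λ (x′ , y′ , y≤x′ , x′≤y′ , y′≤y , proper , _) →
        proper (≤-antisym (≤-trans x′≤y′ y′≤y) y≤x′ , ≤-antisym y′≤y (≤-trans y≤x′ x′≤y′))))

  step-describes : ∀ {x y A₁ A₂} → x ≤ y → Describes x y A₁ → Describes (suc x) (suc y) A₂ →
    Describes x (suc y) (step A₁ A₂)
  step-describes x≤y d₁ d₂ = mkAtom-describes
    (λ p m → ⇔.trans T-∧ (⇔.trans (d₁ m ×-⇔ d₂ m) (⇔.sym (prop-split L x≤y p))))
    (λ ψ m → let m₀ = dia∈SF φ m in
      ⇔.trans T-∨ (⇔.trans (d₁ m ⊎-⇔ ⇔.trans T-∨ (d₂ m ⊎-⇔ ⇔.trans T-∨ (d₁ m₀ ⊎-⇔ d₂ m₀)))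
                          (⇔.sym (dia-split L x≤y ψ))))

  -- row = A_x ⋯ A_0 with A_i the atom of [i, y].
  data DescribesRow (y : ℕ) : ℕ → Row n → Set where
    [_] : ∀ {A} → Describes 0 y A → DescribesRow y 0 (A ∷ [])
    _∷_ : ∀ {x A row} → Describes (suc x) y A → DescribesRow y x row → DescribesRow y (suc x) (A ∷ row)

  succ'-describes : ∀ {x y row B} → x ≤ y → DescribesRow y x row → Describes (suc x) (suc y) B →
    DescribesRow (suc y) (suc x) (succ' row B)
  succ'-describes x≤y [ d ] dB = dB ∷ [ step-describes x≤y d dB ]
  succ'-describes x≤y (d ∷ ds) dB =
    dB ∷ succ'-describes (≤-trans (n≤1+n _) x≤y) ds (step-describes x≤y d dB)

  lastOr-describes : ∀ {x y row} A → DescribesRow y x row → Describes 0 y (lastOr φ A row)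
  lastOr-describes A [ d ] = d
  lastOr-describes A (d ∷ ds) = lastOr-describes _ ds

succ* : ∀ {n} → Row n → List (Subset n) → Row n
succ* = foldl (λ e P → succ' e (atomOf P))

module _ {n} (φ : Form n) where

  succMin* : Row n → List (Subset n) → Row n
  succMin* = foldl (λ r P → succMin φ r (atomOf P))

  run≡succMin* : ∀ P Ps → run φ (P ∷ Ps) ≡ just (succMin* (atomOf P ∷ []) Ps)
  run≡succMin* P Ps = go (atomOf P ∷ []) Ps
    where
      go : ∀ r Ps → foldl (δ φ) (just r) Ps ≡ just (succMin* r Ps)
      go r [] = refl
      go r (Q ∷ Qs) = go (succMin φ r (atomOf Q)) Qs

  succMin*-∼* : ∀ {r e} Ps → _∼*_ φ r e → _∼*_ φ (succMin* r Ps) (succ* e Ps)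
  succMin*-∼* [] r∼*e = r∼*e
  succMin*-∼* (P ∷ Ps) r∼*e = succMin*-∼* Ps (succMin-∼* φ (atomOf P) r∼*e)

  -- Stated for every i, not only i < length Ps: for L = letterℕ w both
  -- sides fall back to the same default letter past the end of w.
  succ*-describes : ∀ (L : ℕ → Subset n) d Ps {y e} → DescribesRow φ L y y e →
    (∀ i → lookupOr d Ps i ≡ L (suc y + i)) →
    DescribesRow φ L (y + length Ps) (y + length Ps) (succ* e Ps)
  succ*-describes L d [] {y} de _ = subst (λ t → DescribesRow φ L t t _) (sym (+-identityʳ y)) de
  succ*-describes L d (Q ∷ Qs) {y} {e} de agree =
    subst (λ t → DescribesRow φ L t t (succ* e (Q ∷ Qs))) (sym (+-suc y (length Qs)))
      (succ*-describes L d Qs (succ'-describes φ L ≤-refl de dQ)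
        (λ i → trans (agree (suc i)) (cong L (cong suc (+-suc y i)))))
    where
      dQ : Describes φ L (suc y) (suc y) (atomOf Q)
      dQ = subst (λ P → Describes φ L (suc y) (suc y) (atomOf P))
        (sym (trans (agree 0) (cong L (cong suc (+-identityʳ y))))) (atomOf-describes φ L (suc y))

  last≡lastOr : ∀ A r → List.last (A ∷ r) ≡ just (lastOr φ A r)
  last≡lastOr A [] = refl
  last≡lastOr A (B ∷ r) = last≡lastOr B r

  -- The default atom contains nothing, so the empty row is rejected too.
  accepting≡lastOr : ∀ r → accepting φ (just r) ≡ lastOr φ (λ _ → false) r φ
  accepting≡lastOr [] = refl
  accepting≡lastOr (A ∷ r) rewrite last≡lastOr A r = refl

theorem4p7 : ∀ {n : ℕ} (φ : Form n) (w : List⁺ (Subset n)) →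
    Accepts φ w ⇔ (w ⊨ φ)
theorem4p7 φ w@(P ∷ Ps) = begin
  Accepts φ w                          ≡⟨ cong (T ∘ accepting φ) (run≡succMin* φ P Ps) ⟩
  T (accepting φ (just r))             ≡⟨ cong T (accepting≡lastOr φ r) ⟩
  T (lastOr φ none r φ)                ≡⟨ cong T (_≈_.agree same-last (SF-refl φ)) ⟩
  T (lastOr φ none e φ)                ≈⟨ lastOr-describes φ L none e-describes (SF-refl φ) ⟩
  Satℕ L 0 (length Ps) φ               ≡⟨ cong (λ y → Satℕ L 0 y φ) (sym (toℕ-fromℕ (length Ps))) ⟩
  Satℕ L 0 (toℕ (fromℕ (length Ps))) φ ≈⟨ ⇔.sym (Sat⇔Satℕ w φ fzero (fromℕ (length Ps))) ⟩
  w ⊨ φ                                ∎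
  where
    open import Relation.Binary.Reasoning.Setoid (⇔.⇔-setoid 0ℓ)
    L = letterℕ w
    none = λ (_ : Form _) → false
    r = succMin* φ (atomOf P ∷ []) Ps
    e = succ* (atomOf P ∷ []) Ps
    same-last : _≈_ φ (lastOr φ none r) (lastOr φ none e)
    same-last = lastOr-∼* φ (succMin*-∼* φ Ps ε) (≈-refl φ)
    e-describes : DescribesRow φ L (length Ps) (length Ps) e
    e-describes = succ*-describes φ L P Ps [ atomOf-describes φ L 0 ] (λ _ → refl)
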